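{- Let $n,d$ be positive integers with $d<\lfloor \frac{n}{2}\rfloor$, and let $C_n^d=C_n(\{1,2,\ldots,d\})$ be the $d$-th power of the $n$-cycle. Then \[\nu(C_n^d)=\Big\lfloor \frac{n}{d+2}\Big\rfloor.\]
   Context: For $S\subseteq\{1,2,\ldots,\lfloor n/2\rfloor\}$, the circulant graph $C_n(S)$ has vertex set $\mathbb{Z}_n=\{0,\ldots,n-1\}$ and edge set $\{\{i,j\} : |j-i|_n\in S\}$, where $|k|_n=\min\{|k|,n-|k|\}$. An induced matching of a graph $G$ is a set $C$ of pairwise disjoint edges such that the subgraph of $G$ induced on the vertices covered by $C$ has edge set exactly $C$; $\nu(G)$ is the maximum size of an induced matching of $G$. -}

module Defs where

open import Data.Nat using (ℕ; zero; suc; _+_; _∸_; _≤_; _≤ᵇ_; _⊓_)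
open import Data.Bool using (if_then_else_)
open import Data.Fin using (Fin; toℕ)
open import Data.Product using (Σ; ∃; _×_; _,_; proj₁; proj₂)
open import Data.Sum using (_⊎_)
open import Relation.Binary.PropositionalEquality using (_≡_; _≢_)

absDiff : ℕ → ℕ → ℕ
absDiff i j = if i ≤ᵇ j then j ∸ i else i ∸ j

circDist : (n : ℕ) → Fin n → Fin n → ℕ
circDist n i j = absDiff (toℕ i) (toℕ j) ⊓ (n ∸ absDiff (toℕ i) (toℕ j))

Graph : ℕ → Set₁
Graph n = Fin n → Fin n → Set

Circulant : (n : ℕ) → (S : ℕ → Set) → Graph n
Circulant n S i j = S (circDist n i j)

UpTo : ℕ → ℕ → Set
UpTo d k = (1 ≤ k) × (k ≤ d)

CyclePower : (n d : ℕ) → Graph n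
CyclePower n d = Circulant n (UpTo d)

EdgeFamily : ℕ → ℕ → Set
EdgeFamily n m = Fin m → Fin n × Fin n

Covered : ∀ {n m} → EdgeFamily n m → Fin n → Set
Covered {m = m} C v = ∃ λ (t : Fin m) → (proj₁ (C t) ≡ v) ⊎ (proj₂ (C t) ≡ v)

IsMember : ∀ {n m} → EdgeFamily n m → Fin n → Fin n → Set
IsMember {m = m} C u v = ∃ λ (t : Fin m) →
  ((proj₁ (C t) ≡ u) × (proj₂ (C t) ≡ v)) ⊎ ((proj₁ (C t) ≡ v) × (proj₂ (C t) ≡ u))

-- Induced matching of size m in G:
--  * every e_t is an edge of G;
--  * distinct indices give pairwise disjoint edges (so the m edges are distinct);
--  * the subgraph induced on the covered vertices has exactly these edges.
record IsInducedMatching {n m : ℕ} (G : Graph n) (C : EdgeFamily n m) : Set where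
  field
    edges    : ∀ t → G (proj₁ (C t)) (proj₂ (C t))
    disjoint : ∀ s t → s ≢ t →
                 (proj₁ (C s) ≢ proj₁ (C t)) × (proj₁ (C s) ≢ proj₂ (C t)) ×
                 (proj₂ (C s) ≢ proj₁ (C t)) × (proj₂ (C s) ≢ proj₂ (C t))
    induced  : ∀ u v → Covered C u → Covered C v → G u v → IsMember C u v

HasInducedMatchingOfSize : ∀ {n} → Graph n → ℕ → Set
HasInducedMatchingOfSize {n} G m = Σ (EdgeFamily n m) (IsInducedMatching G)

InducedMatchingNumber : ∀ {n} → Graph n → ℕ → Set
InducedMatchingNumber G k =
  HasInducedMatchingOfSize G k × (∀ m → HasInducedMatchingOfSize G m → m ≤ k)

module Submission where

-- Orient every edge of an induced matching as {a, a ⊕ δ} with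
-- 1 ≤ δ ≤ d (⊕ is addition mod n) and attach to it the block of d+2
-- consecutive vertices a, a ⊕ 1, ..., a ⊕ (d+1).  Endpoints of distinct
-- edges are at circular distance > d (they are distinct and non-adjacent),
-- so two blocks cannot meet: a collision would put the tail of one edge at
-- most d+1 steps after the tail of another, hence at most d steps after one
-- of its endpoints.  Blocks of one edge do not self-overlap because d+1 < n.
-- So m(d+2) ≤ n.  The edges {t(d+2), t(d+2)+1}, t < ⌊n/(d+2)⌋, have pairwise
-- circular distance > d between distinct edges, hence form an induced matching.

open import Defs
open import Data.Nat
open import Data.Nat.Properties
open import Data.Nat.DivMod
open import Data.Bool using (true; false; T)
open import Data.Unit using (tt)
open import Data.Empty using (⊥; ⊥-elim)
open import Data.Product using (∃; _×_; _,_; proj₁; proj₂; uncurry; map₂)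
open import Data.Product.Properties using (×-≡,≡→≡)
open import Data.Sum using (_⊎_; inj₁; inj₂)
open import Data.Fin using (Fin; toℕ; fromℕ<; remQuot; combine) renaming (_≟_ to _≟ᶠ_)
open import Data.Fin.Properties using (toℕ-injective; toℕ-fromℕ<; toℕ<n; toℕ≤pred[n]; combine-remQuot; injective⇒≤)
open import Function using (_∘_)
open import Relation.Nullary using (¬_; Dec; yes; no)
open import Relation.Binary using (tri<; tri≈; tri>)
open import Relation.Binary.PropositionalEquality

absDiff-≤ : ∀ {x y} → x ≤ y → absDiff x y ≡ y ∸ x
absDiff-≤ {x} {y} x≤y with x ≤ᵇ y | ≤⇒≤ᵇ x≤y
... | true | _ = refl

absDiff-> : ∀ {x y} → y < x → absDiff x y ≡ x ∸ y
absDiff-> {x} {y} y<x with x ≤ᵇ y in x≤ᵇy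
... | true  = ⊥-elim (<⇒≱ y<x (≤ᵇ⇒≤ x y (subst T (sym x≤ᵇy) tt)))
... | false = refl

absDiff-sym : ∀ x y → absDiff x y ≡ absDiff y x
absDiff-sym x y with <-cmp x y
... | tri< x<y _ _    = trans (absDiff-≤ (<⇒≤ x<y)) (sym (absDiff-> x<y))
... | tri≈ _ refl _   = refl
... | tri> _ _ y<x    = trans (absDiff-> y<x) (sym (absDiff-≤ (<⇒≤ y<x)))

absDiff-+ : ∀ x a → absDiff x (a + x) ≡ a
absDiff-+ x a = trans (absDiff-≤ (m≤n+m x a)) (m+n∸n≡m a x)

-- Arithmetic on the cycle ℤ_n, with residues represented by naturals < n.
module Circle (n : ℕ) .{{_ : NonZero n}} where

  infixl 6 _⊕_

  _⊕_ : ℕ → ℕ → ℕ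
  x ⊕ k = (x + k) % n

  around : ℕ → ℕ
  around a = a ⊓ (n ∸ a)

  -- circular distance; circDist n i j is definitionally dist (toℕ i) (toℕ j)
  dist : ℕ → ℕ → ℕ
  dist x y = around (absDiff x y)

  dist-sym : ∀ x y → dist x y ≡ dist y x
  dist-sym x y = cong around (absDiff-sym x y)

  dist-self : ∀ x → dist x x ≡ 0
  dist-self x = cong around (absDiff-+ x 0)

  around-flip : ∀ {k} → k ≤ n → around (n ∸ k) ≡ around k
  around-flip {k} k≤n = trans (cong ((n ∸ k) ⊓_) (m∸[m∸n]≡n k≤n)) (⊓-comm (n ∸ k) k)

  around-≥ : ∀ {a b} → b ≤ a → a + b ≤ n → b ≤ around a
  around-≥ {a} {b} b≤a a+b≤n = ⊓-glb b≤a (m+n≤o⇒m≤o∸n b (subst (_≤ n) (+-comm a _) a+b≤n))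

  around≡0 : ∀ {k} → k < n → around k ≡ 0 → k ≡ 0
  around≡0 {k} k<n around≡0 with ⊓-sel k (n ∸ k)
  ... | inj₁ is-k = trans (sym is-k) around≡0
  ... | inj₂ is-rest = ⊥-elim (<⇒≱ k<n (m∸n≡0⇒m≤n (trans (sym is-rest) around≡0)))

  ⊕-identity : ∀ {x} → x < n → x ⊕ 0 ≡ x
  ⊕-identity {x} x<n = trans (cong (_% n) (+-identityʳ x)) (m<n⇒m%n≡m x<n)

  ⊕-assoc : ∀ x i j → x ⊕ i ⊕ j ≡ x ⊕ (i + j)
  ⊕-assoc x i j = begin
      ((x + i) % n + j) % n           ≡⟨ %-distribˡ-+ ((x + i) % n) j n ⟩
      ((x + i) % n % n + j % n) % n   ≡⟨ cong (λ z → (z + j % n) % n) (m%n%n≡m%n (x + i) n) ⟩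
      ((x + i) % n + j % n) % n       ≡⟨ sym (%-distribˡ-+ (x + i) j n) ⟩
      (x + i + j) % n                 ≡⟨ cong (_% n) (+-assoc x i j) ⟩
      (x + (i + j)) % n               ∎
    where open ≡-Reasoning

  ⊕-turn : ∀ x k → x ⊕ (k + n) ≡ x ⊕ k
  ⊕-turn x k = trans (cong (_% n) (sym (+-assoc x k n))) ([m+n]%n≡m%n (x + k) n)

  ⊕-cancel : ∀ {x y i j} → x < n → i ≤ j → j ≤ n → x ⊕ i ≡ y ⊕ j → x ≡ y ⊕ (j ∸ i)
  ⊕-cancel {x} {y} {i} {j} x<n i≤j j≤n same = begin
      x                       ≡⟨ sym (⊕-identity x<n) ⟩
      x ⊕ 0                   ≡⟨ sym (⊕-turn x 0) ⟩
      x ⊕ n                   ≡⟨ cong (x ⊕_) (sym (m+[n∸m]≡n (≤-trans i≤j j≤n))) ⟩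
      x ⊕ (i + (n ∸ i))       ≡⟨ sym (⊕-assoc x i (n ∸ i)) ⟩
      x ⊕ i ⊕ (n ∸ i)         ≡⟨ cong (_⊕ (n ∸ i)) same ⟩
      y ⊕ j ⊕ (n ∸ i)         ≡⟨ ⊕-assoc y j (n ∸ i) ⟩
      y ⊕ (j + (n ∸ i))       ≡⟨ cong (y ⊕_) j+[n∸i]≡[j∸i]+n ⟩
      y ⊕ ((j ∸ i) + n)       ≡⟨ ⊕-turn y (j ∸ i) ⟩
      y ⊕ (j ∸ i)             ∎
    where
      open ≡-Reasoning
      j+[n∸i]≡[j∸i]+n : j + (n ∸ i) ≡ (j ∸ i) + n
      j+[n∸i]≡[j∸i]+n = begin
        j + (n ∸ i)             ≡⟨ cong (_+ (n ∸ i)) (sym (m∸n+n≡m i≤j)) ⟩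
        (j ∸ i) + i + (n ∸ i)   ≡⟨ +-assoc (j ∸ i) i (n ∸ i) ⟩
        (j ∸ i) + (i + (n ∸ i)) ≡⟨ cong ((j ∸ i) +_) (m+[n∸m]≡n (≤-trans i≤j j≤n)) ⟩
        (j ∸ i) + n             ∎

  dist-shift : ∀ {x k} → x < n → k < n → dist x (x ⊕ k) ≡ around k
  dist-shift {x} {k} x<n k<n with x + k <? n
  ... | yes no-wrap = begin
      dist x ((x + k) % n)   ≡⟨ cong (dist x) (m<n⇒m%n≡m no-wrap) ⟩
      dist x (x + k)         ≡⟨ cong (dist x) (+-comm x k) ⟩
      dist x (k + x)         ≡⟨ cong around (absDiff-+ x k) ⟩
      around k               ∎
    where open ≡-Reasoning
  ... | no wraps with r , n+r≡x+k ← m≤n⇒∃[o]m+o≡n (≮⇒≥ wraps) = begin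
      dist x (x ⊕ k)          ≡⟨ cong₂ dist x≡[n∸k]+r x⊕k≡r ⟩
      dist ((n ∸ k) + r) r    ≡⟨ cong around (trans (absDiff-sym _ r) (absDiff-+ r (n ∸ k))) ⟩
      around (n ∸ k)          ≡⟨ around-flip (<⇒≤ k<n) ⟩
      around k                ∎
    where
      open ≡-Reasoning
      x≡[n∸k]+r : x ≡ (n ∸ k) + r
      x≡[n∸k]+r = +-cancelʳ-≡ k _ _ (begin
        x + k               ≡⟨ sym n+r≡x+k ⟩
        n + r               ≡⟨ cong (_+ r) (sym (m∸n+n≡m (<⇒≤ k<n))) ⟩
        (n ∸ k) + k + r     ≡⟨ +-assoc (n ∸ k) k r ⟩
        (n ∸ k) + (k + r)   ≡⟨ cong ((n ∸ k) +_) (+-comm k r) ⟩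
        (n ∸ k) + (r + k)   ≡⟨ sym (+-assoc (n ∸ k) r k) ⟩
        (n ∸ k) + r + k     ∎)
      r<n : r < n
      r<n = ≤-<-trans (subst (r ≤_) (sym x≡[n∸k]+r) (m≤n+m r (n ∸ k))) x<n
      x⊕k≡r : x ⊕ k ≡ r
      x⊕k≡r = begin
        (x + k) % n   ≡⟨ cong (_% n) (trans (sym n+r≡x+k) (+-comm n r)) ⟩
        (r + n) % n   ≡⟨ [m+n]%n≡m%n r n ⟩
        r % n         ≡⟨ m<n⇒m%n≡m r<n ⟩
        r             ∎

  dist-shift-≤ : ∀ {x k} → x < n → k < n → dist x (x ⊕ k) ≤ k
  dist-shift-≤ x<n k<n = ≤-trans (≤-reflexive (dist-shift x<n k<n)) (m⊓n≤m _ _)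

  shift-fixed : ∀ {x k} → x < n → k < n → x ⊕ k ≡ x → k ≡ 0
  shift-fixed {x} x<n k<n fixed =
    around≡0 k<n (trans (sym (dist-shift x<n k<n)) (trans (cong (dist x) fixed) (dist-self x)))

  reach : ∀ {x y} → x < n → y < n → ∃ λ k → k < n × y ≡ x ⊕ k
  reach {x} {y} x<n y<n with y <? x
  ... | no y≮x = y ∸ x , ≤-<-trans (m∸n≤m y x) y<n ,
        sym (trans (cong (_% n) (m+[n∸m]≡n (≮⇒≥ y≮x))) (m<n⇒m%n≡m y<n))
  ... | yes y<x = (n ∸ x) + y ,
        subst ((n ∸ x) + y <_) (m∸n+n≡m (<⇒≤ x<n)) (+-monoʳ-< (n ∸ x) y<x) , sym x⊕k≡y
    where
      open ≡-Reasoning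
      x⊕k≡y : x ⊕ ((n ∸ x) + y) ≡ y
      x⊕k≡y = begin
        (x + ((n ∸ x) + y)) % n   ≡⟨ cong (_% n) (sym (+-assoc x (n ∸ x) y)) ⟩
        (x + (n ∸ x) + y) % n     ≡⟨ cong (λ z → (z + y) % n) (m+[n∸m]≡n (<⇒≤ x<n)) ⟩
        (n + y) % n               ≡⟨ cong (_% n) (+-comm n y) ⟩
        (y + n) % n               ≡⟨ [m+n]%n≡m%n y n ⟩
        y % n                     ≡⟨ m<n⇒m%n≡m y<n ⟩
        y                         ∎

  dist≡0⇒≡ : ∀ {x y} → x < n → y < n → dist x y ≡ 0 → x ≡ y
  dist≡0⇒≡ {x} {y} x<n y<n dist≡0 with reach x<n y<n
  ... | k , k<n , refl with around≡0 k<n (trans (sym (dist-shift x<n k<n)) dist≡0)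
  ...   | refl = sym (⊕-identity x<n)

  orient : ∀ {d x y} → x < n → y < n → 1 ≤ dist x y → dist x y ≤ d →
           ∃ λ δ → 1 ≤ δ × δ ≤ d × ((y ≡ x ⊕ δ) ⊎ (x ≡ y ⊕ δ))
  orient {d} {x} x<n y<n 1≤dist dist≤d with reach x<n y<n
  ... | k , k<n , refl with ⊓-sel k (n ∸ k) | dist-shift x<n k<n
  ...   | inj₁ around≡k | dist≡ =
          k , subst (1 ≤_) (trans dist≡ around≡k) 1≤dist ,
          subst (_≤ d) (trans dist≡ around≡k) dist≤d , inj₁ refl
  ...   | inj₂ around≡n∸k | dist≡ =
          n ∸ k , subst (1 ≤_) (trans dist≡ around≡n∸k) 1≤dist ,
          subst (_≤ d) (trans dist≡ around≡n∸k) dist≤d , inj₂ back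
    where
      open ≡-Reasoning
      back : x ≡ x ⊕ k ⊕ (n ∸ k)
      back = begin
        x                   ≡⟨ sym (⊕-identity x<n) ⟩
        x ⊕ 0               ≡⟨ sym (⊕-turn x 0) ⟩
        x ⊕ n               ≡⟨ cong (x ⊕_) (sym (m+[n∸m]≡n (<⇒≤ k<n))) ⟩
        x ⊕ (k + (n ∸ k))   ≡⟨ sym (⊕-assoc x k (n ∸ k)) ⟩
        x ⊕ k ⊕ (n ∸ k)     ∎

  dist-step : ∀ {x} → suc x < n → dist x (suc x) ≡ 1
  dist-step {x} x+1<n = trans (cong around (absDiff-+ x 1))
    (m≤n⇒m⊓n≡m (m+n≤o⇒m≤o∸n 1 (≤-trans (s≤s (s≤s z≤n)) x+1<n)))

  dist-≥ : ∀ {x y b} → x + b ≤ y → y + b ≤ n → b ≤ dist x y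
  dist-≥ {x} {y} {b} x+b≤y y+b≤n rewrite absDiff-≤ (≤-trans (m≤m+n x b) x+b≤y) =
    around-≥ (m+n≤o⇒m≤o∸n b (subst (_≤ y) (+-comm x b) x+b≤y))
             (≤-trans (+-monoˡ-≤ b (m∸n≤m y x)) y+b≤n)

Endpoint : ∀ {n m} → EdgeFamily n m → Fin m → Fin n → Set
Endpoint C t x = (proj₁ (C t) ≡ x) ⊎ (proj₂ (C t) ≡ x)

Separated : ∀ {n m} → Graph n → EdgeFamily n m → Set
Separated G C = ∀ {s t x y} → s ≢ t → Endpoint C s x → Endpoint C t y → x ≢ y × ¬ G x y

module _ {n m} {G : Graph n} {C : EdgeFamily n m} (M : IsInducedMatching G C) where
  open IsInducedMatching M

  endpoint-unique : ∀ {s t x} → Endpoint C s x → Endpoint C t x → s ≡ t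
  endpoint-unique {s} {t} p q with s ≟ᶠ t
  ... | yes s≡t = s≡t
  ... | no s≢t with disjoint s t s≢t | p | q
  ...   | ne₁₁ , _ , _ , _ | inj₁ p | inj₁ q = ⊥-elim (ne₁₁ (trans p (sym q)))
  ...   | _ , ne₁₂ , _ , _ | inj₁ p | inj₂ q = ⊥-elim (ne₁₂ (trans p (sym q)))
  ...   | _ , _ , ne₂₁ , _ | inj₂ p | inj₁ q = ⊥-elim (ne₂₁ (trans p (sym q)))
  ...   | _ , _ , _ , ne₂₂ | inj₂ p | inj₂ q = ⊥-elim (ne₂₂ (trans p (sym q)))

  -- an induced matching is separated: an edge between two of its edges would
  -- itself have to be one of its edges, sharing endpoints with both
  matching-separated : Separated G C
  matching-separated {s} {t} {x} {y} s≢t ex ey = distinct , non-adjacent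
    where
      distinct : x ≢ y
      distinct refl = s≢t (endpoint-unique ex ey)
      non-adjacent : ¬ G x y
      non-adjacent adj with induced x y (s , ex) (t , ey) adj
      ... | r , inj₁ (p , q) = s≢t (trans (endpoint-unique ex (inj₁ p)) (endpoint-unique (inj₂ q) ey))
      ... | r , inj₂ (p , q) = s≢t (trans (endpoint-unique ex (inj₂ q)) (endpoint-unique (inj₁ p) ey))

separated-matching : ∀ {n m} {G : Graph n} {C : EdgeFamily n m} →
  (∀ x → ¬ G x x) → (∀ t → G (proj₁ (C t)) (proj₂ (C t))) → Separated G C →
  IsInducedMatching G C
separated-matching {G = G} {C} loopless edges sep = record
  { edges    = edges
  ; disjoint = λ s t s≢t →
      proj₁ (sep s≢t (inj₁ refl) (inj₁ refl)) , proj₁ (sep s≢t (inj₁ refl) (inj₂ refl)) ,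
      proj₁ (sep s≢t (inj₂ refl) (inj₁ refl)) , proj₁ (sep s≢t (inj₂ refl) (inj₂ refl))
  ; induced  = induced
  }
  where
    loop : ∀ {u v} → u ≡ v → ¬ G u v
    loop refl = loopless _
    induced : ∀ u v → Covered C u → Covered C v → G u v → IsMember C u v
    induced u v (s , eu) (t , ev) adj with s ≟ᶠ t
    ... | no s≢t = ⊥-elim (proj₂ (sep s≢t eu ev) adj)
    induced u v (s , inj₁ p) (s , inj₁ q) adj | yes refl = ⊥-elim (loop (trans (sym p) q) adj)
    induced u v (s , inj₂ p) (s , inj₂ q) adj | yes refl = ⊥-elim (loop (trans (sym p) q) adj)
    induced u v (s , inj₁ p) (s , inj₂ q) adj | yes refl = s , inj₁ (p , q)
    induced u v (s , inj₂ p) (s , inj₁ q) adj | yes refl = s , inj₂ (q , p)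

-- Separation in C_n^d is exactly circular distance > d.
module PowerSeparation (n d : ℕ) .{{_ : NonZero n}} where
  open Circle n

  loopless : ∀ x → ¬ CyclePower n d x x
  loopless x (1≤dist , _) = <⇒≱ 1≤dist (≤-reflexive (dist-self (toℕ x)))

  far⇒separated : ∀ {x y : Fin n} → d < dist (toℕ x) (toℕ y) → x ≢ y × ¬ CyclePower n d x y
  far⇒separated {x} far = (λ { refl → <⇒≱ far (≤-trans (≤-reflexive (dist-self (toℕ x))) z≤n) })
                        , (λ adj → <⇒≱ far (proj₂ adj))

  separated⇒far : ∀ {x y : Fin n} → x ≢ y → ¬ CyclePower n d x y → d < dist (toℕ x) (toℕ y)
  separated⇒far {x} {y} x≢y ¬adj with d <? dist (toℕ x) (toℕ y)
  ... | yes far = far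
  ... | no near = ⊥-elim (¬adj (positive , ≮⇒≥ near))
    where
      positive : 1 ≤ dist (toℕ x) (toℕ y)
      positive = n≢0⇒n>0 (x≢y ∘ toℕ-injective ∘ dist≡0⇒≡ (toℕ<n x) (toℕ<n y))

module UpperBound {n d m : ℕ} .{{_ : NonZero n}} (d+1<n : suc d < n)
                  {C : EdgeFamily n m} (M : IsInducedMatching (CyclePower n d) C) where
  open Circle n
  open PowerSeparation n d using (separated⇒far)
  open IsInducedMatching M using (edges)

  d<n : d < n
  d<n = ≤-<-trans (n≤1+n d) d+1<n

  apart : ∀ {s t x y} → s ≢ t → Endpoint C s x → Endpoint C t y → d < dist (toℕ x) (toℕ y)
  apart s≢t ex ey = uncurry separated⇒far (matching-separated M s≢t ex ey)

  not-shortly-after : ∀ {s t x y w} → s ≢ t → Endpoint C s x → Endpoint C t y →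
                      toℕ x ≡ toℕ y ⊕ w → w ≤ d → ⊥
  not-shortly-after {y = y} s≢t ex ey x≡y⊕w w≤d =
    <⇒≱ (apart (s≢t ∘ sym) ey ex)
      (≤-trans (≤-reflexive (cong (dist (toℕ y)) x≡y⊕w))
               (≤-trans (dist-shift-≤ (toℕ<n y) (≤-<-trans w≤d d<n)) w≤d))

  record Oriented (t : Fin m) : Set where
    field
      tail head : Fin n
      tail-end  : Endpoint C t tail
      head-end  : Endpoint C t head
      gap       : ℕ
      gap≥1     : 1 ≤ gap
      gap≤d     : gap ≤ d
      head≡     : toℕ head ≡ toℕ tail ⊕ gap

  orient-edge : ∀ t → Oriented t
  orient-edge t with orient (toℕ<n (proj₁ (C t))) (toℕ<n (proj₂ (C t))) (proj₁ (edges t)) (proj₂ (edges t))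
  ... | δ , 1≤δ , δ≤d , inj₁ forward = record
        { tail = proj₁ (C t) ; head = proj₂ (C t) ; tail-end = inj₁ refl ; head-end = inj₂ refl
        ; gap = δ ; gap≥1 = 1≤δ ; gap≤d = δ≤d ; head≡ = forward }
  ... | δ , 1≤δ , δ≤d , inj₂ backward = record
        { tail = proj₂ (C t) ; head = proj₁ (C t) ; tail-end = inj₂ refl ; head-end = inj₁ refl
        ; gap = δ ; gap≥1 = 1≤δ ; gap≤d = δ≤d ; head≡ = backward }

  -- tail t, head t, gap t, ... name the fields of the chosen orientation of edge t
  open module OrientedEdge t = Oriented (orient-edge t)

  start : Fin m → ℕ
  start t = toℕ (tail t)

  starts-apart : ∀ {s t k} → s ≢ t → start s ≡ start t ⊕ k → k ≤ suc d → ⊥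
  starts-apart {s} {t} {k} s≢t s≡t⊕k k≤d+1 with k ≤? d
  ... | yes k≤d = not-shortly-after s≢t (tail-end s) (tail-end t) s≡t⊕k k≤d
  ... | no k≰d  = not-shortly-after s≢t (tail-end s) (head-end t) s≡head⊕rest rest≤d
    where
      open ≡-Reasoning
      rest : ℕ
      rest = suc d ∸ gap t
      rest≤d : rest ≤ d
      rest≤d = ∸-monoʳ-≤ (suc d) (gap≥1 t)
      s≡head⊕rest : start s ≡ toℕ (head t) ⊕ rest
      s≡head⊕rest = begin
        start s                    ≡⟨ s≡t⊕k ⟩
        start t ⊕ k                ≡⟨ cong (start t ⊕_) (≤-antisym k≤d+1 (≰⇒> k≰d)) ⟩
        start t ⊕ suc d            ≡⟨ cong (start t ⊕_) (sym (m+[n∸m]≡n (m≤n⇒m≤1+n (gap≤d t)))) ⟩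
        start t ⊕ (gap t + rest)   ≡⟨ sym (⊕-assoc (start t) (gap t) rest) ⟩
        start t ⊕ gap t ⊕ rest     ≡⟨ cong (_⊕ rest) (sym (head≡ t)) ⟩
        toℕ (head t) ⊕ rest        ∎

  block : Fin m → Fin (suc (suc d)) → Fin n
  block t i = fromℕ< (m%n<n (start t + toℕ i) n)

  block-collision : ∀ {s t i j} → i ≤ j → j ≤ suc d → start s ⊕ i ≡ start t ⊕ j → s ≡ t × i ≡ j
  block-collision {s} {t} {i} {j} i≤j j≤d+1 meet = resolve (s ≟ᶠ t)
    where
      s≡t⊕[j∸i] : start s ≡ start t ⊕ (j ∸ i)
      s≡t⊕[j∸i] = ⊕-cancel (toℕ<n (tail s)) i≤j (≤-trans j≤d+1 (<⇒≤ d+1<n)) meet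
      resolve : Dec (s ≡ t) → s ≡ t × i ≡ j
      resolve (no s≢t)  = ⊥-elim (starts-apart s≢t s≡t⊕[j∸i] (≤-trans (m∸n≤m j i) j≤d+1))
      resolve (yes s≡t) = s≡t , ≤-antisym i≤j (m∸n≡0⇒m≤n j∸i≡0)
        where
          j∸i≡0 : j ∸ i ≡ 0
          j∸i≡0 = shift-fixed (toℕ<n (tail s)) (≤-<-trans (≤-trans (m∸n≤m j i) j≤d+1) d+1<n)
                    (sym (subst (λ u → start s ≡ start u ⊕ (j ∸ i)) (sym s≡t) s≡t⊕[j∸i]))

  block-meet : ∀ {s t i j} → block s i ≡ block t j → start s ⊕ toℕ i ≡ start t ⊕ toℕ j
  block-meet eq = trans (sym (toℕ-fromℕ< _)) (trans (cong toℕ eq) (toℕ-fromℕ< _))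

  block-injective-≤ : ∀ {s t i j} → toℕ i ≤ toℕ j → block s i ≡ block t j → (s , i) ≡ (t , j)
  block-injective-≤ {s} {t} {i} {j} i≤j eq = ×-≡,≡→≡ (map₂ toℕ-injective
    (block-collision i≤j (toℕ≤pred[n] j) (block-meet {s} {t} {i} {j} eq)))

  block-injective : ∀ {p q} → uncurry block p ≡ uncurry block q → p ≡ q
  block-injective {s , i} {t , j} eq with ≤-total (toℕ i) (toℕ j)
  ... | inj₁ i≤j = block-injective-≤ i≤j eq
  ... | inj₂ j≤i = sym (block-injective-≤ j≤i (sym eq))

  -- the m blocks are disjoint sets of d+2 vertices
  matching-bound : m * suc (suc d) ≤ n
  matching-bound = injective⇒≤ {f = uncurry block ∘ remQuot (suc (suc d))} injective
    where
      injective : ∀ {a b} → uncurry block (remQuot (suc (suc d)) a) ≡ uncurry block (remQuot (suc (suc d)) b) → a ≡ b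
      injective {a} {b} eq = trans (sym (combine-remQuot {m} (suc (suc d)) a))
        (trans (cong (uncurry combine) (block-injective eq)) (combine-remQuot {m} (suc (suc d)) b))

module LowerBound {n d k : ℕ} .{{_ : NonZero n}} (d≥1 : 1 ≤ d) (room : k * suc (suc d) ≤ n) where
  open Circle n
  open PowerSeparation n d using (loopless; far⇒separated)

  q : ℕ
  q = suc (suc d)

  pos : ℕ → ℕ → ℕ
  pos t e = e + t * q

  pos-next : ∀ t {e} → e ≤ 1 → pos t e + suc d ≤ suc t * q
  pos-next t {e} e≤1 = begin
      e + t * q + suc d   ≤⟨ +-monoˡ-≤ (suc d) (+-monoˡ-≤ (t * q) e≤1) ⟩
      1 + t * q + suc d   ≡⟨ cong suc (+-comm (t * q) (suc d)) ⟩
      suc t * q           ∎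
    where open ≤-Reasoning

  pos-gap : ∀ {s t e e′} → s < t → e ≤ 1 → pos s e + suc d ≤ pos t e′
  pos-gap {s} {t} {e} {e′} s<t e≤1 =
    ≤-trans (pos-next s e≤1) (≤-trans (*-monoˡ-≤ q s<t) (m≤n+m (t * q) e′))

  pos-room : ∀ {t e} → t < k → e ≤ 1 → pos t e + suc d ≤ n
  pos-room {t} t<k e≤1 = ≤-trans (pos-next t e≤1) (≤-trans (*-monoˡ-≤ q t<k) room)

  pos<n : ∀ (t : Fin k) {e} → e ≤ 1 → pos (toℕ t) e < n
  pos<n t e≤1 = <-≤-trans (m<m+n _ z<s) (pos-room (toℕ<n t) e≤1)

  pos-far : ∀ {s t e e′} → s ≢ t → s < k → t < k → e ≤ 1 → e′ ≤ 1 → d < dist (pos s e) (pos t e′)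
  pos-far {s} {t} {e} {e′} s≢t s<k t<k e≤1 e′≤1 with <-cmp s t
  ... | tri< s<t _ _ = dist-≥ (pos-gap s<t e≤1) (pos-room t<k e′≤1)
  ... | tri≈ _ s≡t _ = ⊥-elim (s≢t s≡t)
  ... | tri> _ _ t<s = subst (d <_) (dist-sym (pos t e′) (pos s e))
                         (dist-≥ (pos-gap t<s e′≤1) (pos-room s<k e≤1))

  family : EdgeFamily n k
  family t = fromℕ< (pos<n t z≤n) , fromℕ< (pos<n t (s≤s z≤n))

  family-edges : ∀ t → CyclePower n d (proj₁ (family t)) (proj₂ (family t))
  family-edges t = subst₂ (λ a b → UpTo d (dist a b))
    (sym (toℕ-fromℕ< (pos<n t z≤n))) (sym (toℕ-fromℕ< (pos<n t (s≤s z≤n))))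
    (subst (UpTo d) (sym (dist-step (pos<n t (s≤s z≤n)))) (≤-refl , d≥1))

  endpoint-pos : ∀ {t x} → Endpoint family t x → ∃ λ e → e ≤ 1 × toℕ x ≡ pos (toℕ t) e
  endpoint-pos {t} (inj₁ refl) = 0 , z≤n , toℕ-fromℕ< (pos<n t z≤n)
  endpoint-pos {t} (inj₂ refl) = 1 , s≤s z≤n , toℕ-fromℕ< (pos<n t (s≤s z≤n))

  family-separated : Separated (CyclePower n d) family
  family-separated {s} {t} s≢t ex ey with endpoint-pos {s} ex | endpoint-pos {t} ey
  ... | e , e≤1 , x≡ | e′ , e′≤1 , y≡ = far⇒separated
        (subst₂ (λ a b → d < dist a b) (sym x≡) (sym y≡)
          (pos-far (s≢t ∘ toℕ-injective) (toℕ<n s) (toℕ<n t) e≤1 e′≤1))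

  matching : HasInducedMatchingOfSize (CyclePower n d) k
  matching = family , separated-matching loopless family-edges family-separated

half-room : ∀ {n d} → d < n / 2 → suc d < n
half-room {n} {d} d<n/2 = begin-strict
    suc d       <⟨ m<m*n (suc d) 2 (s≤s (s≤s z≤n)) ⟩
    suc d * 2   ≤⟨ *-monoˡ-≤ 2 d<n/2 ⟩
    n / 2 * 2   ≤⟨ m/n*n≤m n 2 ⟩
    n           ∎
  where open ≤-Reasoning

corollary3p3 : (n d : ℕ) → 0 < n → 0 < d → d < n / 2 →
    InducedMatchingNumber (CyclePower n d) (n / suc (suc d))
corollary3p3 n d 0<n 0<d d<n/2 = lower , upper
  where
    instance
      n≢0 : NonZero n
      n≢0 = >-nonZero 0<n
    q : ℕ
    q = suc (suc d)
    lower : HasInducedMatchingOfSize (CyclePower n d) (n / q)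
    lower = LowerBound.matching 0<d (m/n*n≤m n q)
    upper : ∀ m → HasInducedMatchingOfSize (CyclePower n d) m → m ≤ n / q
    upper m (C , M) = begin
        m           ≡⟨ sym (m*n/n≡m m q) ⟩
        m * q / q   ≤⟨ /-monoˡ-≤ q (UpperBound.matching-bound (half-room d<n/2) M) ⟩
        n / q       ∎
      where open ≤-Reasoning
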